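{- For all integers $k\ge 0$ and $\ell\ge 1$, the number $\mathfrak{p}_k(\ell)$ of partitions of $\ell$ into exactly $k$ parts equals the number of permutations $w\in\mathfrak{S}(132)$ with $\ell(w)=\ell$ and $w(1)=k+1$.
   Context: $\mathfrak{S}_n$ is the symmetric group on $\{1,\dots,n\}$ in one-line notation; $\ell(w)$ is the number of inversions $|\{i<j:w(i)>w(j)\}|$. A permutation $w$ avoids $132$ if there are no $i<j<k$ with $w(i)<w(k)<w(j)$. $\mathfrak{S}(132)$ is the set of all permutations $w\in\mathfrak{S}_n$, over all $n$, such that $w$ avoids $132$ and $w(n)\ne n$. -}

module Defs where

open import Data.Nat using (ℕ; zero; suc; _≤_; _≥_)
open import Data.Fin using (Fin; toℕ; fromℕ; _<_; _≟_) renaming (zero to fzero)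
open import Data.Fin.Properties using (all?; _<?_)
open import Data.Vec using (Vec; lookup)
open import Data.List using (List; length; filter; cartesianProduct; allFin)
open import Data.Nat.ListAction using (sum)
open import Data.List.Relation.Unary.All using (All)
open import Data.List.Relation.Unary.Linked using (Linked)
open import Data.Product using (Σ; _×_; _,_)
open import Relation.Nullary using (¬_; Dec; ¬?)
open import Relation.Nullary.Decidable using (True; _×-dec_; _→-dec_)
open import Relation.Binary.PropositionalEquality using (_≡_)

-- Permutations in one-line notation.
-- A word w ∈ Vec (Fin n) n lists w(1),…,w(n) (positions and values are
-- 0-indexed internally: the paper's w(i) = toℕ (lookup w (i-1)) + 1).

IsPerm : ∀ {n} → Vec (Fin n) n → Set
IsPerm {n} w = ∀ (i j : Fin n) → lookup w i ≡ lookup w j → i ≡ j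

isPerm? : ∀ {n} (w : Vec (Fin n) n) → Dec (IsPerm w)
isPerm? w = all? λ i → all? λ j → (lookup w i ≟ lookup w j) →-dec (i ≟ j)

Avoids132 : ∀ {n} → Vec (Fin n) n → Set
Avoids132 {n} w = ∀ (i j k : Fin n) → i < j → j < k →
  ¬ (lookup w i < lookup w k × lookup w k < lookup w j)

avoids132? : ∀ {n} (w : Vec (Fin n) n) → Dec (Avoids132 w)
avoids132? w = all? λ i → all? λ j → all? λ k →
  (i <? j) →-dec ((j <? k) →-dec
    ¬? ((lookup w i <? lookup w k) ×-dec (lookup w k <? lookup w j)))

inv : ∀ {n} → Vec (Fin n) n → ℕ
inv {n} w = length (filter (λ { (i , j) → (i <? j) ×-dec (lookup w j <? lookup w i) })
                           (cartesianProduct (allFin n) (allFin n)))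

-- Decidable side conditions are wrapped in 'True' so that an
-- element of this type is determined by (n , w) alone.
S132With : (ℓ k : ℕ) → Set
S132With ℓ k =
  Σ ℕ λ m → Σ (Vec (Fin (suc m)) (suc m)) λ w →
    True (isPerm? w) ×
    True (avoids132? w) ×
    True (¬? (lookup w (fromℕ m) ≟ fromℕ m)) ×
    inv w ≡ ℓ ×
    toℕ (lookup w fzero) ≡ k

PartitionsInto : (ℓ k : ℕ) → Set
PartitionsInto ℓ k =
  Σ (List ℕ) λ xs →
    Linked _≥_ xs × All (λ x → 1 ≤ x) xs × length xs ≡ k × sum xs ≡ ℓ

-- The inversion table of a permutation w of {1,…,n} lists, for each value i, the number bᵢ ≤ n − i
-- of larger entries to the left of i; it determines w, and ℓ(w) = Σ bᵢ.  Building w by inserting a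
-- new minimum at position b₁ into the permutation with table (b₂,…,bₙ) shows that w avoids 132 iff
-- b is weakly decreasing, that w(1) − 1 is the number of leading positive bᵢ, and that w(n) ≠ n iff
-- some positive bᵢ equals n − i.  So for w ∈ 𝔖(132) the positive entries of b form a partition of
-- ℓ(w) into w(1) − 1 parts; conversely a nonempty partition, padded with zeros, is the table of
-- exactly one such w, whose size n = max (λᵢ + i) is forced by the condition on w(n).

module Submission where

open import Defs

open import Data.Bool.Properties using (T-irrelevant)
open import Data.Empty using (⊥)
open import Data.Fin as Fin using (Fin; toℕ; fromℕ; punchIn; punchOut) renaming (zero to 0F; suc to 1+)
import Data.Fin.Properties as Finₚ
open import Data.List as List using (List; []; _∷_; _++_; length; filter; map; cartesianProduct; tabulate; allFin)
import Data.List.Properties as Listₚ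
open import Data.List.Relation.Unary.All as All using (All; []; _∷_)
open import Data.List.Relation.Unary.Linked as Linked using (Linked; []; [-]; _∷_)
open import Data.Nat as ℕ using (ℕ; zero; suc; _+_; _⊔_; _≤_; _<_; _≥_; z≤n; s≤s; z<s; s<s)
import Data.Nat.Properties as ℕₚ
open import Data.Nat.ListAction using (sum)
open import Data.Product using (∃; _×_; _,_; proj₁; proj₂)
open import Data.Sum using (_⊎_; inj₁; inj₂)
open import Data.Unit using (⊤; tt)
open import Data.Vec as Vec using (Vec; []; _∷_; lookup; insertAt)
import Data.Vec.Properties as Vecₚ
open import Function using (_∘_)
open import Function.Bundles using (_↔_; _⇔_; mk⇔; Equivalence; mk↔ₛ′)
open import Relation.Binary.Definitions using (tri<; tri≈; tri>)
open import Relation.Binary.PropositionalEquality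
open import Relation.Nullary using (¬_; Dec; yes; no; contradiction; Irrelevant)
open import Relation.Nullary.Decidable using (_×-dec_; True; toWitness; fromWitness)
open import Relation.Unary using (Pred; Decidable)

open import Algebra.Properties.CommutativeMonoid.Sum ℕₚ.+-0-commutativeMonoid
  using (sum-syntax; sum-cong-≗; sum-replicate-zero; sum-remove; ∑-distrib-+)

-- Counting inversions

indicator : ∀ {p} {P : Set p} → Dec P → ℕ
indicator (yes _) = 1
indicator (no _)  = 0

indicator-cong : ∀ {p q} {P : Set p} {Q : Set q} (P? : Dec P) (Q? : Dec Q) →
                 (P → Q) → (Q → P) → indicator P? ≡ indicator Q?
indicator-cong (yes _) (yes _) _   _   = refl
indicator-cong (yes p) (no ¬q) P→Q _   = contradiction (P→Q p) ¬q
indicator-cong (no ¬p) (yes q) _   Q→P = contradiction (Q→P q) ¬p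
indicator-cong (no _)  (no _)  _   _   = refl

indicator-¬ : ∀ {p} {P : Set p} (P? : Dec P) → ¬ P → indicator P? ≡ 0
indicator-¬ (yes p) ¬p = contradiction p ¬p
indicator-¬ (no _)  _  = refl

module _ {a p} {A : Set a} {P : Pred A p} (P? : Decidable P) where

  length-filter-tabulate : ∀ {n} (f : Fin n → A) →
    length (filter P? (tabulate f)) ≡ ∑[ i < n ] indicator (P? (f i))
  length-filter-tabulate {zero}  f = refl
  length-filter-tabulate {suc n} f with P? (f 0F)
  ... | yes _ = cong suc (length-filter-tabulate (f ∘ 1+))
  ... | no _  = length-filter-tabulate (f ∘ 1+)

  length-filter-map : ∀ {b} {B : Set b} (g : B → A) (xs : List B) →
    length (filter P? (map g xs)) ≡ length (filter (P? ∘ g) xs)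
  length-filter-map g []       = refl
  length-filter-map g (x ∷ xs) with P? (g x)
  ... | yes _ = cong suc (length-filter-map g xs)
  ... | no _  = length-filter-map g xs

module _ {a b p} {A : Set a} {B : Set b} {P : Pred (A × B) p} (P? : Decidable P) where

  length-filter-cartesianProduct : ∀ {n} (f : Fin n → A) (ys : List B) →
    length (filter P? (cartesianProduct (tabulate f) ys))
      ≡ ∑[ i < n ] length (filter (λ y → P? (f i , y)) ys)
  length-filter-cartesianProduct {zero}  f ys = refl
  length-filter-cartesianProduct {suc n} f ys = begin
    length (filter P? (map (f 0F ,_) ys ++ cartesianProduct (tabulate (f ∘ 1+)) ys))
      ≡⟨ cong length (Listₚ.filter-++ P? (map (f 0F ,_) ys) _) ⟩
    length (filter P? (map (f 0F ,_) ys) ++ filter P? (cartesianProduct (tabulate (f ∘ 1+)) ys))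
      ≡⟨ Listₚ.length-++ (filter P? (map (f 0F ,_) ys)) ⟩
    length (filter P? (map (f 0F ,_) ys)) + length (filter P? (cartesianProduct (tabulate (f ∘ 1+)) ys))
      ≡⟨ cong₂ _+_ (length-filter-map P? (f 0F ,_) ys) (length-filter-cartesianProduct (f ∘ 1+) ys) ⟩
    _ ∎
    where open ≡-Reasoning

∑-zero : ∀ n {f : Fin n → ℕ} → (∀ i → f i ≡ 0) → ∑[ i < n ] f i ≡ 0
∑-zero n f≗0 = trans (sum-cong-≗ f≗0) (sum-replicate-zero n)

count-< : ∀ m t → t ≤ m → ∑[ i < m ] indicator (toℕ i ℕ.<? t) ≡ t
count-< m       zero    _         = ∑-zero m (λ i → indicator-¬ (toℕ i ℕ.<? 0) λ ())
count-< (suc m) (suc t) (s≤s t≤m) = cong suc (begin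
  ∑[ i < m ] indicator (suc (toℕ i) ℕ.<? suc t)
    ≡⟨ sum-cong-≗ {m} (λ i → indicator-cong (suc (toℕ i) ℕ.<? suc t) (toℕ i ℕ.<? t) ℕ.s<s⁻¹ s<s) ⟩
  ∑[ i < m ] indicator (toℕ i ℕ.<? t)
    ≡⟨ count-< m t t≤m ⟩
  t ∎)
  where open ≡-Reasoning

inversion? : ∀ {n} (w : Vec (Fin n) n) (i j : Fin n) → Dec (i Fin.< j × lookup w j Fin.< lookup w i)
inversion? w i j = (i Finₚ.<? j) ×-dec (lookup w j Finₚ.<? lookup w i)

inv≡∑∑inversion : ∀ {n} (w : Vec (Fin n) n) → inv w ≡ ∑[ i < n ] ∑[ j < n ] indicator (inversion? w i j)
inv≡∑∑inversion {n} w =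
  trans (length-filter-cartesianProduct _ {n} (λ i → i) (allFin n))
        (sum-cong-≗ {n} λ i → length-filter-tabulate (inversion? w i) (λ j → j))

punchIn-cases : ∀ {m} (p i : Fin (suc m)) → i ≡ p ⊎ ∃ λ j → i ≡ punchIn p j
punchIn-cases p i with p Finₚ.≟ i
... | yes p≡i = inj₁ (sym p≡i)
... | no p≢i  = inj₂ (punchOut p≢i , sym (Finₚ.punchIn-punchOut p≢i))

punchIn-<-mono : ∀ {m} (p : Fin (suc m)) {j k : Fin m} → j Fin.< k → punchIn p j Fin.< punchIn p k
punchIn-<-mono 0F     j<k = s<s j<k
punchIn-<-mono (1+ p) {0F}   {1+ k} _         = z<s
punchIn-<-mono (1+ p) {1+ j} {1+ k} (s<s j<k) = s<s (punchIn-<-mono p j<k)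

punchIn-<-cancel : ∀ {m} (p : Fin (suc m)) {j k : Fin m} → punchIn p j Fin.< punchIn p k → j Fin.< k
punchIn-<-cancel 0F     (s<s j<k) = j<k
punchIn-<-cancel (1+ p) {0F}   {1+ k} _         = z<s
punchIn-<-cancel (1+ p) {1+ j} {1+ k} (s<s j<k) = s<s (punchIn-<-cancel p j<k)

≤⇒<-punchIn : ∀ {m} (p : Fin (suc m)) (j : Fin m) → toℕ p ≤ toℕ j → p Fin.< punchIn p j
≤⇒<-punchIn 0F     j      _         = z<s
≤⇒<-punchIn (1+ p) (1+ j) (s≤s p≤j) = s<s (≤⇒<-punchIn p j p≤j)

<-punchIn⇒≤ : ∀ {m} (p : Fin (suc m)) (j : Fin m) → p Fin.< punchIn p j → toℕ p ≤ toℕ j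
<-punchIn⇒≤ 0F     j      _         = z≤n
<-punchIn⇒≤ (1+ p) (1+ j) (s<s p<j) = s≤s (<-punchIn⇒≤ p j p<j)

<⇒punchIn-< : ∀ {m} (p : Fin (suc m)) (j : Fin m) → toℕ j < toℕ p → punchIn p j Fin.< p
<⇒punchIn-< (1+ p) 0F     _         = z<s
<⇒punchIn-< (1+ p) (1+ j) (s<s j<p) = s<s (<⇒punchIn-< p j j<p)

punchIn-<⇒< : ∀ {m} (p : Fin (suc m)) (j : Fin m) → punchIn p j Fin.< p → toℕ j < toℕ p
punchIn-<⇒< (1+ p) 0F     _         = z<s
punchIn-<⇒< (1+ p) (1+ j) (s<s j<p) = s<s (punchIn-<⇒< p j j<p)

-- Inserting and removing the minimum

insertMin : ∀ {m} → Fin (suc m) → Vec (Fin m) m → Vec (Fin (suc m)) (suc m)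
insertMin p v = insertAt (Vec.map 1+ v) p 0F

lookup-insertMin-at : ∀ {m} (p : Fin (suc m)) (v : Vec (Fin m) m) → lookup (insertMin p v) p ≡ 0F
lookup-insertMin-at p v = Vecₚ.insertAt-lookup (Vec.map 1+ v) p 0F

lookup-insertMin-punchIn : ∀ {m} (p : Fin (suc m)) (v : Vec (Fin m) m) (j : Fin m) →
                           lookup (insertMin p v) (punchIn p j) ≡ 1+ (lookup v j)
lookup-insertMin-punchIn p v j =
  trans (Vecₚ.insertAt-punchIn (Vec.map 1+ v) p 0F j) (Vecₚ.lookup-map j 1+ v)

-- The new minimum forms an inversion exactly with the toℕ p entries before it.
inv-insertMin : ∀ {m} (p : Fin (suc m)) (v : Vec (Fin m) m) → inv (insertMin p v) ≡ toℕ p + inv v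
inv-insertMin {m} p v = begin
  inv w
    ≡⟨ inv≡∑∑inversion w ⟩
  ∑[ i < suc m ] ∑[ j < suc m ] I w i j
    ≡⟨ sum-remove {i = p} (λ i → ∑[ j < suc m ] I w i j) ⟩
  ∑[ j < suc m ] I w p j + ∑[ i < m ] ∑[ j < suc m ] I w (punchIn p i) j
    ≡⟨ cong₂ _+_ (∑-zero (suc m) no-inversion-from-p)
                 (sum-cong-≗ {m} λ i → sum-remove {i = p} (I w (punchIn p i))) ⟩
  ∑[ i < m ] (I w (punchIn p i) p + ∑[ j < m ] I w (punchIn p i) (punchIn p j))
    ≡⟨ sum-cong-≗ {m} (λ i → cong₂ _+_ (inversion-into-p i) (sum-cong-≗ {m} (inversion-off-p i))) ⟩
  ∑[ i < m ] (indicator (toℕ i ℕ.<? toℕ p) + ∑[ j < m ] I v i j)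
    ≡⟨ ∑-distrib-+ (λ i → indicator (toℕ i ℕ.<? toℕ p)) (λ i → ∑[ j < m ] I v i j) ⟩
  ∑[ i < m ] indicator (toℕ i ℕ.<? toℕ p) + ∑[ i < m ] ∑[ j < m ] I v i j
    ≡⟨ cong₂ _+_ (count-< m (toℕ p) (ℕ.s≤s⁻¹ (Finₚ.toℕ<n p))) (sym (inv≡∑∑inversion v)) ⟩
  toℕ p + inv v ∎
  where
  open ≡-Reasoning
  w = insertMin p v
  I : ∀ {n} → Vec (Fin n) n → Fin n → Fin n → ℕ
  I u i j = indicator (inversion? u i j)

  no-inversion-from-p : ∀ j → I w p j ≡ 0
  no-inversion-from-p j = indicator-¬ (inversion? w p j) λ (_ , wj<wp) →
    ℕₚ.n≮0 (subst (lookup w j Fin.<_) (lookup-insertMin-at p v) wj<wp)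

  inversion-into-p : ∀ i → I w (punchIn p i) p ≡ indicator (toℕ i ℕ.<? toℕ p)
  inversion-into-p i = indicator-cong (inversion? w (punchIn p i)  p) (toℕ i ℕ.<? toℕ p)
    (λ (i<p , _) → punchIn-<⇒< p i i<p)
    (λ i<p → <⇒punchIn-< p i i<p ,
             subst₂ Fin._<_ (sym (lookup-insertMin-at p v)) (sym (lookup-insertMin-punchIn p v i)) z<s)

  inversion-off-p : ∀ i j → I w (punchIn p i) (punchIn p j) ≡ I v i j
  inversion-off-p i j = indicator-cong (inversion? w (punchIn p i) (punchIn p j)) (inversion? v i j)
    (λ (i<j , wj<wi) → punchIn-<-cancel p i<j , ℕ.s<s⁻¹ (subst₂ Fin._<_ wj wi wj<wi))
    (λ (i<j , vj<vi) → punchIn-<-mono p i<j , subst₂ Fin._<_ (sym wj) (sym wi) (s<s vj<vi))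
    where
    wi = lookup-insertMin-punchIn p v i
    wj = lookup-insertMin-punchIn p v j

insertMin-isPerm : ∀ {m} (p : Fin (suc m)) (v : Vec (Fin m) m) → IsPerm v → IsPerm (insertMin p v)
insertMin-isPerm p v v-perm i j wi≡wj with punchIn-cases p i | punchIn-cases p j
... | inj₁ refl        | inj₁ refl        = refl
... | inj₁ refl        | inj₂ (j′ , refl) =
  contradiction (trans (sym (lookup-insertMin-at p v)) (trans wi≡wj (lookup-insertMin-punchIn p v j′))) λ ()
... | inj₂ (i′ , refl) | inj₁ refl        =
  contradiction (trans (sym (lookup-insertMin-at p v)) (trans (sym wi≡wj) (lookup-insertMin-punchIn p v i′))) λ ()
... | inj₂ (i′ , refl) | inj₂ (j′ , refl) = cong (punchIn p) (v-perm i′ j′ (Finₚ.suc-injective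
  (trans (sym (lookup-insertMin-punchIn p v i′)) (trans wi≡wj (lookup-insertMin-punchIn p v j′)))))

-- The first position holding 0F (the last position if there is none).
zeroIndex : ∀ {k n} → Vec (Fin (suc k)) (suc n) → Fin (suc n)
zeroIndex             (0F   ∷ _)  = 0F
zeroIndex {n = zero}  (1+ _ ∷ _)  = 0F
zeroIndex {n = suc n} (1+ _ ∷ xs) = 1+ (zeroIndex xs)

lookup-zeroIndex : ∀ {k n} (w : Vec (Fin (suc k)) (suc n)) {q} → lookup w q ≡ 0F → lookup w (zeroIndex w) ≡ 0F
lookup-zeroIndex             (0F   ∷ _)  _               = refl
lookup-zeroIndex {n = zero}  (1+ _ ∷ _)  {0F}    ()
lookup-zeroIndex {n = suc n} (1+ _ ∷ xs) {1+ q}  wq≡0 = lookup-zeroIndex xs wq≡0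

zeroIndex-insertMin : ∀ {k n} (p : Fin (suc n)) (v : Vec (Fin k) n) → zeroIndex (insertAt (Vec.map 1+ v) p 0F) ≡ p
zeroIndex-insertMin {n = zero}  0F     []      = refl
zeroIndex-insertMin {n = suc n} 0F     v       = refl
zeroIndex-insertMin {n = suc n} (1+ p) (_ ∷ v) = cong 1+ (zeroIndex-insertMin p v)

isPerm⇒hits-0F : ∀ {m} (w : Vec (Fin (suc m)) (suc m)) → IsPerm w → ∃ λ q → lookup w q ≡ 0F
isPerm⇒hits-0F {m} w w-perm with Finₚ.any? (λ i → lookup w i Finₚ.≟ 0F)
... | yes hit  = hit
... | no  ¬hit =
  let i , j , i<j , eq = Finₚ.pigeonhole (ℕₚ.n<1+n m) (λ i → punchOut (≢0F i)) in
  contradiction (w-perm i j (Finₚ.punchOut-injective (≢0F i) (≢0F j) eq)) (ℕₚ.<⇒≢ i<j ∘ cong toℕ)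
  where
  ≢0F : ∀ i → 0F ≢ lookup w i
  ≢0F i 0≡wi = ¬hit (i , sym 0≡wi)

isPerm⇒lookup-zeroIndex : ∀ {m} (w : Vec (Fin (suc m)) (suc m)) → IsPerm w → lookup w (zeroIndex w) ≡ 0F
isPerm⇒lookup-zeroIndex w w-perm = lookup-zeroIndex w (proj₂ (isPerm⇒hits-0F w w-perm))

-- The fallback d is only reached on non-permutations.
predOr : ∀ {m} → Fin m → Fin (suc m) → Fin m
predOr d 0F     = d
predOr d (1+ x) = x

suc-predOr : ∀ {m} (d : Fin m) {x : Fin (suc m)} → x ≢ 0F → 1+ (predOr d x) ≡ x
suc-predOr d {0F}   x≢0 = contradiction refl x≢0
suc-predOr d {1+ x} _   = refl

removeMin : ∀ {m} → Vec (Fin (suc m)) (suc m) → Vec (Fin m) m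
removeMin w = Vec.tabulate λ j → predOr j (lookup w (punchIn (zeroIndex w) j))

removeMin-insertMin : ∀ {m} (p : Fin (suc m)) (v : Vec (Fin m) m) → removeMin (insertMin p v) ≡ v
removeMin-insertMin p v rewrite zeroIndex-insertMin p v = begin
  Vec.tabulate (λ j → predOr j (lookup (insertMin p v) (punchIn p j)))
    ≡⟨ Vecₚ.tabulate-cong (λ j → cong (predOr j) (lookup-insertMin-punchIn p v j)) ⟩
  Vec.tabulate (lookup v)
    ≡⟨ Vecₚ.tabulate∘lookup v ⟩
  v ∎
  where open ≡-Reasoning

module _ {m} (w : Vec (Fin (suc m)) (suc m)) (w-perm : IsPerm w) where

  private
    p = zeroIndex w

    lookup-punchIn-≢0F : ∀ j → lookup w (punchIn p j) ≢ 0F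
    lookup-punchIn-≢0F j eq =
      Finₚ.punchInᵢ≢i p j (w-perm _ _ (trans eq (sym (isPerm⇒lookup-zeroIndex w w-perm))))

    suc-lookup-removeMin : ∀ j → 1+ (lookup (removeMin w) j) ≡ lookup w (punchIn p j)
    suc-lookup-removeMin j =
      trans (cong 1+ (Vecₚ.lookup∘tabulate _ j)) (suc-predOr j (lookup-punchIn-≢0F j))

  insertMin-removeMin : insertMin p (removeMin w) ≡ w
  insertMin-removeMin = begin
    insertMin p (removeMin w)                         ≡⟨ Vecₚ.tabulate∘lookup _ ⟨
    Vec.tabulate (lookup (insertMin p (removeMin w))) ≡⟨ Vecₚ.tabulate-cong same-entries ⟩
    Vec.tabulate (lookup w)                           ≡⟨ Vecₚ.tabulate∘lookup w ⟩
    w                                                 ∎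
    where
    open ≡-Reasoning
    same-entries : ∀ i → lookup (insertMin p (removeMin w)) i ≡ lookup w i
    same-entries i with punchIn-cases p i
    ... | inj₁ refl       = trans (lookup-insertMin-at p _) (sym (isPerm⇒lookup-zeroIndex w w-perm))
    ... | inj₂ (j , refl) = trans (lookup-insertMin-punchIn p _ j) (suc-lookup-removeMin j)

  removeMin-isPerm : IsPerm (removeMin w)
  removeMin-isPerm i j eq = Finₚ.punchIn-injective p i j (w-perm _ _
    (trans (sym (suc-lookup-removeMin i)) (trans (cong 1+ eq) (suc-lookup-removeMin j))))

-- Inversion tables

-- The entry for value i is the number of entries to the left of i that exceed it.
invTable : ∀ {n} → Vec (Fin n) n → List ℕ
invTable {zero}  _ = []
invTable {suc m} w = toℕ (zeroIndex w) ∷ invTable (removeMin w)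

invTable-insertMin : ∀ {m} (p : Fin (suc m)) (v : Vec (Fin m) m) →
                     invTable (insertMin p v) ≡ toℕ p ∷ invTable v
invTable-insertMin p v =
  cong₂ (λ q u → toℕ q ∷ invTable u) (zeroIndex-insertMin p v) (removeMin-insertMin p v)

length-invTable : ∀ {n} (w : Vec (Fin n) n) → length (invTable w) ≡ n
length-invTable {zero}  w = refl
length-invTable {suc m} w = cong suc (length-invTable (removeMin w))

Bounded : ℕ → List ℕ → Set
Bounded n       []       = ⊤
Bounded zero    (_ ∷ _)  = ⊥
Bounded (suc n) (x ∷ xs) = x ≤ n × Bounded n xs

invTable-bounded : ∀ {n} (w : Vec (Fin n) n) → Bounded n (invTable w)
invTable-bounded {zero}  w = tt
invTable-bounded {suc m} w = ℕ.s≤s⁻¹ (Finₚ.toℕ<n (zeroIndex w)) , invTable-bounded (removeMin w)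

module _ (P : ∀ {n} → Vec (Fin n) n → List ℕ → Set)
         (P[] : P [] [])
         (P-insertMin : ∀ {m} (p : Fin (suc m)) (v : Vec (Fin m) m) → IsPerm v →
                        P v (invTable v) → P (insertMin p v) (toℕ p ∷ invTable v))
         where

  invTable-induction : ∀ {n} (w : Vec (Fin n) n) → IsPerm w → P w (invTable w)
  invTable-induction {zero}  []  _      = P[]
  invTable-induction {suc m} w   w-perm = subst (λ u → P u (invTable w)) (insertMin-removeMin w w-perm)
    (P-insertMin (zeroIndex w) (removeMin w) v-perm (invTable-induction (removeMin w) v-perm))
    where v-perm = removeMin-isPerm w w-perm

inv≡sum-invTable : ∀ {n} (w : Vec (Fin n) n) → IsPerm w → inv w ≡ sum (invTable w)
inv≡sum-invTable = invTable-induction (λ w t → inv w ≡ sum t) refl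
  λ p v _ ih → trans (inv-insertMin p v) (cong (toℕ p +_) ih)

head₀ : List ℕ → ℕ
head₀ []      = 0
head₀ (x ∷ _) = x

padZeros : ℕ → List ℕ → List ℕ
padZeros zero    _  = []
padZeros (suc n) xs = head₀ xs ∷ padZeros n (List.drop 1 xs)

clamp : ℕ → (m : ℕ) → Fin (suc m)
clamp zero    m       = 0F
clamp (suc x) zero    = 0F
clamp (suc x) (suc m) = 1+ (clamp x m)

toℕ-clamp : ∀ {x m} → x ≤ m → toℕ (clamp x m) ≡ x
toℕ-clamp z≤n       = refl
toℕ-clamp (s≤s x≤m) = cong suc (toℕ-clamp x≤m)

clamp-toℕ : ∀ {m} (p : Fin (suc m)) → clamp (toℕ p) m ≡ p
clamp-toℕ         0F     = refl
clamp-toℕ {suc m} (1+ p) = cong 1+ (clamp-toℕ p)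

decode : (n : ℕ) → List ℕ → Vec (Fin n) n
decode zero    _ = []
decode (suc m) t = insertMin (clamp (head₀ t) m) (decode m (List.drop 1 t))

decode-isPerm : ∀ n t → IsPerm (decode n t)
decode-isPerm zero    t ()
decode-isPerm (suc m) t =
  insertMin-isPerm (clamp (head₀ t) m) (decode m (List.drop 1 t)) (decode-isPerm m (List.drop 1 t))

decode-padZeros : ∀ n t → decode n (padZeros n t) ≡ decode n t
decode-padZeros zero    t = refl
decode-padZeros (suc m) t = cong (insertMin _) (decode-padZeros m (List.drop 1 t))

invTable-decode : ∀ n {t} → Bounded n t → invTable (decode n t) ≡ padZeros n t
invTable-decode zero    _ = refl
invTable-decode (suc m) {t} t-bnd = begin
  invTable (insertMin (clamp (head₀ t) m) (decode m (List.drop 1 t)))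
    ≡⟨ invTable-insertMin _ _ ⟩
  toℕ (clamp (head₀ t) m) ∷ invTable (decode m (List.drop 1 t))
    ≡⟨ cong₂ _∷_ (toℕ-clamp (head≤ t t-bnd)) (invTable-decode m (drop-bounded t t-bnd)) ⟩
  head₀ t ∷ padZeros m (List.drop 1 t) ∎
  where
  open ≡-Reasoning
  head≤ : ∀ t → Bounded (suc m) t → head₀ t ≤ m
  head≤ []      _         = z≤n
  head≤ (_ ∷ _) (x≤m , _) = x≤m
  drop-bounded : ∀ t → Bounded (suc m) t → Bounded m (List.drop 1 t)
  drop-bounded []      _          = tt
  drop-bounded (_ ∷ _) (_ , t-bnd) = t-bnd

decode-invTable : ∀ {n} (w : Vec (Fin n) n) → IsPerm w → decode n (invTable w) ≡ w
decode-invTable = invTable-induction (λ {n} w t → decode n t ≡ w) refl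
  λ p v _ ih → cong₂ insertMin (clamp-toℕ p) ih

-- 132-avoidance

IncreasingFrom : ∀ {m} → Fin (suc m) → Vec (Fin m) m → Set
IncreasingFrom {m} p v = ∀ (j k : Fin m) → j Fin.< k → toℕ p ≤ toℕ j → lookup v j Fin.< lookup v k

module _ {m} (p : Fin (suc m)) (v : Vec (Fin m) m) where

  private
    w = insertMin p v

    ≮-at-p : ∀ {i} → ¬ lookup w i Fin.< lookup w p
    ≮-at-p {i} lt = ℕₚ.n≮0 (subst (lookup w i Fin.<_) (lookup-insertMin-at p v) lt)

    at-p-< : ∀ j → lookup w p Fin.< lookup w (punchIn p j)
    at-p-< j = subst₂ Fin._<_ (sym (lookup-insertMin-at p v)) (sym (lookup-insertMin-punchIn p v j)) z<s

    shift-< : ∀ {i j} → lookup v i Fin.< lookup v j → lookup w (punchIn p i) Fin.< lookup w (punchIn p j)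
    shift-< {i} {j} lt =
      subst₂ Fin._<_ (sym (lookup-insertMin-punchIn p v i)) (sym (lookup-insertMin-punchIn p v j)) (s<s lt)

    unshift-< : ∀ {i j} → lookup w (punchIn p i) Fin.< lookup w (punchIn p j) → lookup v i Fin.< lookup v j
    unshift-< {i} {j} lt =
      ℕ.s<s⁻¹ (subst₂ Fin._<_ (lookup-insertMin-punchIn p v i) (lookup-insertMin-punchIn p v j) lt)

  avoids132-insertMin : Avoids132 v → IncreasingFrom p v → Avoids132 w
  avoids132-insertMin v-avoids v-inc i j k i<j j<k (wi<wk , wk<wj) with punchIn-cases p j
  ... | inj₁ refl = ≮-at-p wk<wj
  ... | inj₂ (j′ , refl) with punchIn-cases p k
  ...   | inj₁ refl = ≮-at-p wi<wk
  ...   | inj₂ (k′ , refl) with punchIn-cases p i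
  ...     | inj₁ refl =
    ℕₚ.<-asym (v-inc j′ k′ (punchIn-<-cancel p j<k) (<-punchIn⇒≤ p j′ i<j)) (unshift-< wk<wj)
  ...     | inj₂ (i′ , refl) =
    v-avoids i′ j′ k′ (punchIn-<-cancel p i<j) (punchIn-<-cancel p j<k) (unshift-< wi<wk , unshift-< wk<wj)

  avoids132-insertMin⁻ : Avoids132 w → Avoids132 v
  avoids132-insertMin⁻ w-avoids i j k i<j j<k (vi<vk , vk<vj) =
    w-avoids (punchIn p i) (punchIn p j) (punchIn p k) (punchIn-<-mono p i<j) (punchIn-<-mono p j<k)
      (shift-< vi<vk , shift-< vk<vj)

  avoids132-insertMin⇒increasingFrom : IsPerm v → Avoids132 w → IncreasingFrom p v
  avoids132-insertMin⇒increasingFrom v-perm w-avoids j k j<k p≤j with Finₚ.<-cmp (lookup v j) (lookup v k)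
  ... | tri< vj<vk _ _ = vj<vk
  ... | tri≈ _ vj≡vk _ = contradiction (cong toℕ (v-perm j k vj≡vk)) (ℕₚ.<⇒≢ j<k)
  ... | tri> _ _ vk<vj = contradiction (at-p-< k , shift-< vk<vj)
    (w-avoids p (punchIn p j) (punchIn p k) (≤⇒<-punchIn p j p≤j) (punchIn-<-mono p j<k))

module _ {m} (p : Fin (suc (suc m))) (v : Vec (Fin (suc m)) (suc m)) (v-perm : IsPerm v) where

  private
    q = zeroIndex v
    vq≡0 = isPerm⇒lookup-zeroIndex v v-perm

    at-q-< : ∀ {k} → k ≢ q → lookup v q Fin.< lookup v k
    at-q-< {k} k≢q with lookup v k in vk
    ... | 0F   = contradiction (v-perm k q (trans vk (sym vq≡0))) k≢q
    ... | 1+ _ = subst (Fin._< 1+ _) (sym vq≡0) z<s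

  increasingFrom⇒zeroIndex≤ : IncreasingFrom p v → toℕ q ≤ toℕ p
  increasingFrom⇒zeroIndex≤ v-inc = ℕₚ.≮⇒≥ λ p<q →
    let p<1+m = ℕₚ.<-trans p<q (Finₚ.toℕ<n q)
        j     = Fin.fromℕ< p<1+m
        j≡p   = Finₚ.toℕ-fromℕ< p<1+m
    in ℕₚ.n≮0 (subst (lookup v j Fin.<_) vq≡0
         (v-inc j q (subst (ℕ._< toℕ q) (sym j≡p) p<q) (ℕₚ.≤-reflexive (sym j≡p))))

  zeroIndex≤⇒increasingFrom : Avoids132 v → toℕ q ≤ toℕ p → IncreasingFrom p v
  zeroIndex≤⇒increasingFrom v-avoids q≤p j k j<k p≤j with j Finₚ.≟ q
  ... | yes refl = at-q-< λ { refl → ℕₚ.<-irrefl refl j<k }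
  ... | no  j≢q  with Finₚ.<-cmp (lookup v j) (lookup v k)
  ...   | tri< vj<vk _ _ = vj<vk
  ...   | tri≈ _ vj≡vk _ = contradiction (cong toℕ (v-perm j k vj≡vk)) (ℕₚ.<⇒≢ j<k)
  ...   | tri> _ _ vk<vj =
    contradiction (at-q-< (λ { refl → ℕₚ.<-asym q<j j<k }) , vk<vj) (v-avoids q j k q<j j<k)
    where
    q<j : q Fin.< j
    q<j = ℕₚ.≤∧≢⇒< (ℕₚ.≤-trans q≤p p≤j) (j≢q ∘ Finₚ.toℕ-injective ∘ sym)

increasingFrom⇔decreasing : ∀ {m} (p : Fin (suc m)) (v : Vec (Fin m) m) → IsPerm v → Avoids132 v →
  Linked _≥_ (invTable v) → IncreasingFrom p v ⇔ Linked _≥_ (toℕ p ∷ invTable v)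
increasingFrom⇔decreasing {zero}  p [] _ _ _ = mk⇔ (λ _ → [-]) (λ _ ())
increasingFrom⇔decreasing {suc m} p v v-perm v-avoids t-decr = mk⇔
  (λ v-inc → increasingFrom⇒zeroIndex≤ p v v-perm v-inc ∷ t-decr)
  (λ { (q≤p ∷ _) → zeroIndex≤⇒increasingFrom p v v-perm v-avoids q≤p })

avoids132⇔decreasing-invTable : ∀ {n} (w : Vec (Fin n) n) → IsPerm w → Avoids132 w ⇔ Linked _≥_ (invTable w)
avoids132⇔decreasing-invTable =
  invTable-induction (λ w t → Avoids132 w ⇔ Linked _≥_ t) (mk⇔ (λ _ → []) (λ _ ())) step
  where
  step : ∀ {m} (p : Fin (suc m)) (v : Vec (Fin m) m) → IsPerm v → Avoids132 v ⇔ Linked _≥_ (invTable v) →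
         Avoids132 (insertMin p v) ⇔ Linked _≥_ (toℕ p ∷ invTable v)
  step p v v-perm ih = mk⇔
    (λ w-avoids → let v-avoids = avoids132-insertMin⁻ p v w-avoids in
      Equivalence.to (increasingFrom⇔decreasing p v v-perm v-avoids (Equivalence.to ih v-avoids))
                     (avoids132-insertMin⇒increasingFrom p v v-perm w-avoids))
    (λ decr → let v-avoids = Equivalence.from ih (Linked.tail decr) in
      avoids132-insertMin p v v-avoids
        (Equivalence.from (increasingFrom⇔decreasing p v v-perm v-avoids (Linked.tail decr)) decr))

-- The first and last entries

positivePrefix : List ℕ → List ℕ
positivePrefix []           = []
positivePrefix (zero  ∷ _)  = []
positivePrefix (suc x ∷ xs) = suc x ∷ positivePrefix xs

toℕ-lookup-0F≡length-positivePrefix : ∀ {m} (w : Vec (Fin (suc m)) (suc m)) → IsPerm w →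
  toℕ (lookup w 0F) ≡ length (positivePrefix (invTable w))
toℕ-lookup-0F≡length-positivePrefix w@(_ ∷ _) =
  invTable-induction (λ w t → toℕ-head w ≡ length (positivePrefix t)) refl step w
  where
  toℕ-head : ∀ {n} → Vec (Fin n) n → ℕ
  toℕ-head []      = 0
  toℕ-head (x ∷ _) = toℕ x

  step : ∀ {m} (p : Fin (suc m)) (v : Vec (Fin m) m) → IsPerm v →
         toℕ-head v ≡ length (positivePrefix (invTable v)) →
         toℕ-head (insertMin p v) ≡ length (positivePrefix (toℕ p ∷ invTable v))
  step 0F      v       _ _  = refl
  step (1+ p) (_ ∷ _) _ ih = cong suc ih

-- The empty permutation counts as fixing its last point, so that ¬lastFixed⇔saturated holds for n = 0.
LastFixed : ∀ {n} → Vec (Fin n) n → Set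
LastFixed {zero}  _ = ⊤
LastFixed {suc m} w = lookup w (fromℕ m) ≡ fromℕ m

-- Some positive entry attains the bound `Bounded` puts on it: the number of entries after it.
Saturated : List ℕ → Set
Saturated []       = ⊥
Saturated (x ∷ xs) = (0 < x × x ≡ length xs) ⊎ Saturated xs

punchIn-fromℕ : ∀ {m} (p : Fin (suc (suc m))) → p ≢ fromℕ (suc m) →
                punchIn p (fromℕ m) ≡ fromℕ (suc m)
punchIn-fromℕ         0F      _    = refl
punchIn-fromℕ {zero}  (1+ 0F) p≢1  = contradiction refl p≢1
punchIn-fromℕ {suc m} (1+ p)  p≢1+ = cong 1+ (punchIn-fromℕ p (p≢1+ ∘ cong 1+))

¬lastFixed⇔saturated : ∀ {n} (w : Vec (Fin n) n) → IsPerm w → (¬ LastFixed w) ⇔ Saturated (invTable w)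
¬lastFixed⇔saturated =
  invTable-induction (λ w t → (¬ LastFixed w) ⇔ Saturated t) (mk⇔ (λ ¬⊤ → ¬⊤ tt) λ ()) step
  where
  step : ∀ {m} (p : Fin (suc m)) (v : Vec (Fin m) m) → IsPerm v → (¬ LastFixed v) ⇔ Saturated (invTable v) →
         (¬ LastFixed (insertMin p v)) ⇔ Saturated (toℕ p ∷ invTable v)
  step {zero}  0F [] _ _ = mk⇔ (λ ¬fixed → contradiction refl ¬fixed) λ { (inj₁ (() , _)) ; (inj₂ ()) }
  step {suc m} p  v  _ ih with p Finₚ.≟ fromℕ (suc m)
  ... | yes refl = mk⇔
    (λ _ → inj₁ (subst (0 <_) (sym p≡1+m) z<s , trans p≡1+m (sym (length-invTable v))))
    (λ _ fixed → contradiction (trans (sym (lookup-insertMin-at p v)) fixed) λ ())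
    where p≡1+m = Finₚ.toℕ-fromℕ (suc m)
  ... | no p≢last = mk⇔
    (λ ¬fixed → inj₂ (Equivalence.to ih λ fixed → ¬fixed (trans last≡ (cong 1+ fixed))))
    λ { (inj₁ (_ , p≡len)) _ → p≢last (Finₚ.toℕ-injective
                                 (trans p≡len (trans (length-invTable v) (sym (Finₚ.toℕ-fromℕ (suc m))))))
      ; (inj₂ sat) fixed → Equivalence.from ih sat (Finₚ.suc-injective (trans (sym last≡) fixed)) }
    where
    last≡ : lookup (insertMin p v) (fromℕ (suc m)) ≡ 1+ (lookup v (fromℕ m))
    last≡ = trans (cong (lookup (insertMin p v)) (sym (punchIn-fromℕ p p≢last)))
                  (lookup-insertMin-punchIn p v (fromℕ m))

-- Partitions

Positive : List ℕ → Set
Positive = All (λ x → 1 ≤ x)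

minSize : List ℕ → ℕ
minSize []       = 0
minSize (x ∷ xs) = suc (x ⊔ minSize xs)

bounded-mono : ∀ {n n′} xs → n ≤ n′ → Bounded n xs → Bounded n′ xs
bounded-mono []       _          _              = tt
bounded-mono (x ∷ xs) (s≤s n≤n′) (x≤n , xs-bnd) =
  ℕₚ.≤-trans x≤n n≤n′ , bounded-mono xs n≤n′ xs-bnd

bounded-minSize : ∀ xs → Bounded (minSize xs) xs
bounded-minSize []       = tt
bounded-minSize (x ∷ xs) =
  ℕₚ.m≤m⊔n x (minSize xs) , bounded-mono xs (ℕₚ.m≤n⊔m x (minSize xs)) (bounded-minSize xs)

minSize-least : ∀ {n} xs → Bounded n xs → minSize xs ≤ n
minSize-least         []       _              = z≤n
minSize-least {suc n} (x ∷ xs) (x≤n , xs-bnd) = s≤s (ℕₚ.⊔-lub x≤n (minSize-least xs xs-bnd))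

length-padZeros : ∀ n xs → length (padZeros n xs) ≡ n
length-padZeros zero    _  = refl
length-padZeros (suc n) xs = cong suc (length-padZeros n (List.drop 1 xs))

¬saturated-zeros : ∀ n → ¬ Saturated (padZeros n [])
¬saturated-zeros (suc n) (inj₁ (() , _))
¬saturated-zeros (suc n) (inj₂ sat) = ¬saturated-zeros n sat

saturated-minSize : ∀ x xs → Positive (x ∷ xs) → Saturated (padZeros (minSize (x ∷ xs)) (x ∷ xs))
saturated-minSize x xs (0<x ∷ xs-pos) with minSize xs ℕ.≤? x
... | yes size≤x =
  inj₁ (0<x , sym (trans (length-padZeros (x ⊔ minSize xs) xs) (ℕₚ.m≥n⇒m⊔n≡m size≤x)))
saturated-minSize x []       _            | no size≰x = contradiction z≤n size≰x
saturated-minSize x (y ∷ ys) (_ ∷ xs-pos) | no size≰x =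
  inj₂ (subst (λ n → Saturated (padZeros n (y ∷ ys)))
              (sym (ℕₚ.m≤n⇒m⊔n≡n (ℕₚ.<⇒≤ (ℕₚ.≰⇒> size≰x))))
              (saturated-minSize y ys xs-pos))

saturated⇒≡minSize : ∀ n xs → Bounded n xs → Saturated (padZeros n xs) → n ≡ minSize xs
saturated⇒≡minSize n       []       _              sat = contradiction sat (¬saturated-zeros n)
saturated⇒≡minSize (suc n) (x ∷ xs) (x≤n , xs-bnd) (inj₁ (_ , x≡len)) =
  cong suc (trans (sym x≡n)
    (sym (ℕₚ.m≥n⇒m⊔n≡m (subst (minSize xs ≤_) (sym x≡n) (minSize-least xs xs-bnd)))))
  where x≡n = trans x≡len (length-padZeros n xs)
saturated⇒≡minSize (suc n) (x ∷ xs) (x≤n , xs-bnd) (inj₂ sat) =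
  cong suc (trans n≡size (sym (ℕₚ.m≤n⇒m⊔n≡n (subst (x ≤_) n≡size x≤n))))
  where n≡size = saturated⇒≡minSize n xs xs-bnd sat

positivePrefix-padZeros : ∀ n {xs} → Positive xs → Bounded n xs → positivePrefix (padZeros n xs) ≡ xs
positivePrefix-padZeros zero    {[]}         _            _            = refl
positivePrefix-padZeros (suc n) {[]}         _            _            = refl
positivePrefix-padZeros (suc n) {suc x ∷ xs} (_ ∷ xs-pos) (_ , xs-bnd) =
  cong (suc x ∷_) (positivePrefix-padZeros n xs-pos xs-bnd)

padZeros-positivePrefix : ∀ {n} xs → length xs ≡ n → Linked _≥_ xs → padZeros n (positivePrefix xs) ≡ xs
padZeros-positivePrefix []           refl _    = refl
padZeros-positivePrefix (zero  ∷ xs) refl decr = cong (0 ∷_) (zeros xs decr)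
  where
  zeros : ∀ ys → Linked _≥_ (0 ∷ ys) → padZeros (length ys) [] ≡ ys
  zeros []       _            = refl
  zeros (_ ∷ ys) (z≤n ∷ decr) = cong (0 ∷_) (zeros ys decr)
padZeros-positivePrefix (suc x ∷ xs) refl decr =
  cong (suc x ∷_) (padZeros-positivePrefix xs refl (Linked.tail decr))

positivePrefix-positive : ∀ xs → Positive (positivePrefix xs)
positivePrefix-positive []           = []
positivePrefix-positive (zero  ∷ _)  = []
positivePrefix-positive (suc x ∷ xs) = s≤s z≤n ∷ positivePrefix-positive xs

positivePrefix-decreasing : ∀ {xs} → Linked _≥_ xs → Linked _≥_ (positivePrefix xs)
positivePrefix-decreasing {[]}                _            = []
positivePrefix-decreasing {zero  ∷ _}         _            = []
positivePrefix-decreasing {suc x ∷ []}        _            = [-]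
positivePrefix-decreasing {suc x ∷ zero  ∷ _} _            = [-]
positivePrefix-decreasing {suc x ∷ suc y ∷ _} (x≥y ∷ decr) = x≥y ∷ positivePrefix-decreasing decr

bounded-positivePrefix : ∀ n xs → Bounded n xs → Bounded n (positivePrefix xs)
bounded-positivePrefix n       []           _              = tt
bounded-positivePrefix n       (zero  ∷ _)  _              = tt
bounded-positivePrefix (suc n) (suc x ∷ xs) (x≤n , xs-bnd) = x≤n , bounded-positivePrefix n xs xs-bnd

padZeros-decreasing : ∀ n {xs} → Linked _≥_ xs → Linked _≥_ (padZeros n xs)
padZeros-decreasing zero                      _            = []
padZeros-decreasing (suc zero)                _            = [-]
padZeros-decreasing (suc (suc n)) {[]}        _            = z≤n ∷ padZeros-decreasing (suc n) []
padZeros-decreasing (suc (suc n)) {_ ∷ []}    _            = z≤n ∷ padZeros-decreasing (suc n) []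
padZeros-decreasing (suc (suc n)) {_ ∷ _ ∷ _} (x≥y ∷ decr) = x≥y ∷ padZeros-decreasing (suc n) decr

sum-padZeros : ∀ n xs → Bounded n xs → sum (padZeros n xs) ≡ sum xs
sum-padZeros n       []       _            = sum-zeros n
  where
  sum-zeros : ∀ n → sum (padZeros n []) ≡ 0
  sum-zeros zero    = refl
  sum-zeros (suc n) = sum-zeros n
sum-padZeros (suc n) (x ∷ xs) (_ , xs-bnd) = cong (x +_) (sum-padZeros n xs xs-bnd)

Linked-irrelevant : ∀ {a r} {A : Set a} {R : A → A → Set r} → (∀ {x y} → Irrelevant (R x y)) →
                    ∀ {xs} → Irrelevant (Linked R xs)
Linked-irrelevant R-irr []       []         = refl
Linked-irrelevant R-irr [-]      [-]        = refl
Linked-irrelevant R-irr (r ∷ rs) (r′ ∷ rs′) = cong₂ _∷_ (R-irr r r′) (Linked-irrelevant R-irr rs rs′)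

module _ {ℓ k : ℕ} where

  PartitionsInto-≡ : ∀ {xs ys a b} → xs ≡ ys → _≡_ {A = PartitionsInto ℓ k} (xs , a) (ys , b)
  PartitionsInto-≡ {a = decr , pos , len , sm} {b = decr′ , pos′ , len′ , sm′} refl
    rewrite Linked-irrelevant ℕₚ.≤-irrelevant decr decr′ | All.irrelevant ℕₚ.≤-irrelevant pos pos′
          | ℕₚ.≡-irrelevant len len′ | ℕₚ.≡-irrelevant sm sm′ = refl

  S132With-≡ : ∀ {m} {w w′ : Vec (Fin (suc m)) (suc m)} {a b} → w ≡ w′ →
               _≡_ {A = S132With ℓ k} (m , w , a) (m , w′ , b)
  S132With-≡ {a = perm , avoids , ¬fixed , inv≡ , head≡}
             {b = perm′ , avoids′ , ¬fixed′ , inv≡′ , head≡′} refl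
    rewrite T-irrelevant perm perm′ | T-irrelevant avoids avoids′ | T-irrelevant ¬fixed ¬fixed′
          | ℕₚ.≡-irrelevant inv≡ inv≡′ | ℕₚ.≡-irrelevant head≡ head≡′ = refl

  module _ {m} (w : Vec (Fin (suc m)) (suc m)) (perm : True (isPerm? w)) (avoids : True (avoids132? w)) where

    decreasing-invTable : Linked _≥_ (invTable w)
    decreasing-invTable = Equivalence.to (avoids132⇔decreasing-invTable w (toWitness perm)) (toWitness avoids)

    padZeros-positivePrefix-invTable : padZeros (suc m) (positivePrefix (invTable w)) ≡ invTable w
    padZeros-positivePrefix-invTable = padZeros-positivePrefix (invTable w) (length-invTable w) decreasing-invTable

    bounded-positivePrefix-invTable : Bounded (suc m) (positivePrefix (invTable w))
    bounded-positivePrefix-invTable = bounded-positivePrefix (suc m) (invTable w) (invTable-bounded w)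

  toPartition : S132With ℓ k → PartitionsInto ℓ k
  toPartition (m , w , perm , avoids , _ , inv≡ℓ , head≡k) =
    parts , positivePrefix-decreasing (decreasing-invTable w perm avoids) , positivePrefix-positive (invTable w) ,
    trans (sym (toℕ-lookup-0F≡length-positivePrefix w (toWitness perm))) head≡k , sum≡ℓ
    where
    open ≡-Reasoning
    parts = positivePrefix (invTable w)
    sum≡ℓ = begin
      sum parts                    ≡⟨ sum-padZeros (suc m) parts (bounded-positivePrefix-invTable w perm avoids) ⟨
      sum (padZeros (suc m) parts) ≡⟨ cong sum (padZeros-positivePrefix-invTable w perm avoids) ⟩
      sum (invTable w)             ≡⟨ inv≡sum-invTable w (toWitness perm) ⟨
      inv w                        ≡⟨ inv≡ℓ ⟩
      ℓ                            ∎

  fromPartitionOfSize : ∀ n (p : PartitionsInto ℓ k) →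
    Bounded n (proj₁ p) → Saturated (padZeros n (proj₁ p)) → S132With ℓ k
  fromPartitionOfSize (suc m) (xs , decr , pos , len≡k , sum≡ℓ) bnd sat =
    m , w , fromWitness w-perm , fromWitness w-avoids , fromWitness ¬fixed , inv≡ℓ , head≡k
    where
    open ≡-Reasoning
    w = decode (suc m) xs
    w-perm = decode-isPerm (suc m) xs
    table≡ = invTable-decode (suc m) bnd
    w-avoids = Equivalence.from (avoids132⇔decreasing-invTable w w-perm)
                 (subst (Linked _≥_) (sym table≡) (padZeros-decreasing (suc m) decr))
    ¬fixed = Equivalence.from (¬lastFixed⇔saturated w w-perm) (subst Saturated (sym table≡) sat)
    inv≡ℓ = begin
      inv w                     ≡⟨ inv≡sum-invTable w w-perm ⟩
      sum (invTable w)          ≡⟨ cong sum table≡ ⟩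
      sum (padZeros (suc m) xs) ≡⟨ sum-padZeros (suc m) xs bnd ⟩
      sum xs                    ≡⟨ sum≡ℓ ⟩
      ℓ                         ∎
    head≡k = begin
      toℕ (lookup w 0F)                             ≡⟨ toℕ-lookup-0F≡length-positivePrefix w w-perm ⟩
      length (positivePrefix (invTable w))          ≡⟨ cong (length ∘ positivePrefix) table≡ ⟩
      length (positivePrefix (padZeros (suc m) xs)) ≡⟨ cong length (positivePrefix-padZeros (suc m) pos bnd) ⟩
      length xs                                     ≡⟨ len≡k ⟩
      k                                             ∎

  saturated-minSize-partition : 1 ≤ ℓ → (p : PartitionsInto ℓ k) →
                                Saturated (padZeros (minSize (proj₁ p)) (proj₁ p))
  saturated-minSize-partition 1≤ℓ ([]     , _ , _   , _ , sum≡ℓ) =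
    contradiction (subst (1 ≤_) (sym sum≡ℓ) 1≤ℓ) λ ()
  saturated-minSize-partition 1≤ℓ (x ∷ xs , _ , pos , _ , _)     = saturated-minSize x xs pos

  fromPartition : 1 ≤ ℓ → PartitionsInto ℓ k → S132With ℓ k
  fromPartition 1≤ℓ p =
    fromPartitionOfSize (minSize (proj₁ p)) p (bounded-minSize (proj₁ p)) (saturated-minSize-partition 1≤ℓ p)

  toPartition-fromPartitionOfSize : ∀ n p bnd sat → toPartition (fromPartitionOfSize n p bnd sat) ≡ p
  toPartition-fromPartitionOfSize (suc m) (xs , _ , pos , _) bnd _ = PartitionsInto-≡ (begin
    positivePrefix (invTable (decode (suc m) xs)) ≡⟨ cong positivePrefix (invTable-decode (suc m) bnd) ⟩
    positivePrefix (padZeros (suc m) xs)          ≡⟨ positivePrefix-padZeros (suc m) pos bnd ⟩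
    xs                                            ∎)
    where open ≡-Reasoning

  fromPartitionOfSize-toPartition : ∀ s n → n ≡ suc (proj₁ s) → ∀ bnd sat →
                                    fromPartitionOfSize n (toPartition s) bnd sat ≡ s
  fromPartitionOfSize-toPartition (m , w , perm , avoids , _) _ refl _ _ = S132With-≡ (begin
    decode (suc m) parts
      ≡⟨ decode-padZeros (suc m) parts ⟨
    decode (suc m) (padZeros (suc m) parts)
      ≡⟨ cong (decode (suc m)) (padZeros-positivePrefix-invTable w perm avoids) ⟩
    decode (suc m) (invTable w)
      ≡⟨ decode-invTable w (toWitness perm) ⟩
    w ∎)
    where
    open ≡-Reasoning
    parts = positivePrefix (invTable w)

  minSize-toPartition : ∀ s → minSize (proj₁ (toPartition s)) ≡ suc (proj₁ s)
  minSize-toPartition (m , w , perm , avoids , ¬fixed , _) =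
    sym (saturated⇒≡minSize (suc m) _ (bounded-positivePrefix-invTable w perm avoids)
      (subst Saturated (sym (padZeros-positivePrefix-invTable w perm avoids))
        (Equivalence.to (¬lastFixed⇔saturated w (toWitness perm)) (toWitness ¬fixed))))

corollary5p17 : (k ℓ : ℕ) → 1 ≤ ℓ → PartitionsInto ℓ k ↔ S132With ℓ k
corollary5p17 k ℓ 1≤ℓ = mk↔ₛ′ (fromPartition 1≤ℓ) toPartition
  (λ s → fromPartitionOfSize-toPartition s _ (minSize-toPartition s) _ _)
  (λ p → toPartition-fromPartitionOfSize (minSize (proj₁ p)) p _ (saturated-minSize-partition 1≤ℓ p))
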